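{- Let $t\geq 2$ and $\ell\geq 1$ be integers, let $a=2^t$ and $q=t\ell^2$, and let $K_{a,q}$ have parts $A$ (with $|A|=a$) and $Q$ (with $|Q|=q$). Then there exists an assignment of color lists $L$ to the vertices of $K_{a,q}$ with $|L(v)|=t\ell$ for $v\in A$ and $|L(v)|=2$ for $v\in Q$ such that there is no proper coloring $c$ of $K_{a,q}$ with $c(v)\in L(v)$ for all vertices $v$.
   Context: $K_{a,q}$ is the complete bipartite graph with parts of sizes $a$ and $q$. -}

module Defs where

open import Data.Nat using (ℕ; _^_; _*_)
open import Data.Fin using (Fin)
open import Data.List using (List; length)
open import Data.List.Membership.Propositional using (_∈_)
open import Data.List.Relation.Unary.Unique.Propositional using (Unique)
open import Data.Product using (_×_; Σ)
open import Relation.Binary.PropositionalEquality using (_≡_; _≢_)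

IsColorList : ℕ → List ℕ → Set
IsColorList k L = Unique L × length L ≡ k

-- K_{a,q}: vertex set is Fin a (part A) ⊎ Fin q (part Q); edges are exactly the
-- pairs (i , j) with i in A and j in Q. A coloring is given by its two restrictions.
ProperListColoringK : (a q : ℕ) → (Fin a → List ℕ) → (Fin q → List ℕ) →
                      (Fin a → ℕ) → (Fin q → ℕ) → Set
ProperListColoringK a q LA LQ cA cQ =
  ((i : Fin a) → cA i ∈ LA i) ×
  ((j : Fin q) → cQ j ∈ LQ j) ×
  ((i : Fin a) (j : Fin q) → cA i ≢ cQ j)

-- Colors are triples (j , b , k) with j < t, b a side in Fin 2 and k < ℓ. The vertex of A
-- coded by s : Fin t → Fin 2 gets the tℓ colors (j , s j , k); the vertex (j , x , y) of Q
-- gets {(j , 0 , x) , (j , 1 , y)}. For a fixed j, a coloring of the ℓ × ℓ grid of such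
-- Q-vertices either uses (j , 0 , x) for every x, or misses some (j , 0 , x), in which case
-- the whole row x is colored (j , 1 , y) for every y. Either way some side s j has all its
-- colors used on Q, and the A-vertex coded by s then has no color left.
module Submission where

open import Defs
open import Data.Nat using (ℕ; _≤_; _^_; _*_; _≟_)
open import Data.Fin using (Fin; toℕ; combine; remQuot; finToFun; funToFin)
open import Data.Fin.Patterns using (0F; 1F)
open import Data.Fin.Properties
  using (toℕ-injective; combine-injective; remQuot-combine; combine-remQuot; finToFun-funToFin;
         all?; any?; ¬∀⟶∃¬)
open import Data.List using (List; []; _∷_; tabulate)
open import Data.List.Properties using (length-tabulate)
open import Data.List.Membership.Propositional using (_∈_)
open import Data.List.Membership.Propositional.Properties using (∈-tabulate⁻)
open import Data.List.Relation.Unary.Unique.Propositional.Properties using (tabulate⁺)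
open import Data.List.Relation.Unary.AllPairs using ([]; _∷_)
open import Data.List.Relation.Unary.All using ([]; _∷_)
open import Data.List.Relation.Unary.Any using (here; there)
open import Data.Sum using (_⊎_; inj₁; inj₂)
open import Data.Product using (Σ; _×_; _,_; proj₁; proj₂; ∃; uncurry)
open import Function using (_∘_; _∋_)
open import Relation.Nullary using (¬_; yes; no; contradiction)
open import Relation.Binary.Definitions using (DecidableEquality)
open import Relation.Binary.PropositionalEquality using (_≡_; _≢_; refl; sym; trans; cong; subst)

∈-pair⁻ : {A : Set} {x a b : A} → x ∈ a ∷ b ∷ [] → x ≡ a ⊎ x ≡ b
∈-pair⁻ (here x≡a)         = inj₁ x≡a
∈-pair⁻ (there (here x≡b)) = inj₂ x≡b

remQuot-injective : ∀ {n} k {i j : Fin (n * k)} → remQuot {n} k i ≡ remQuot k j → i ≡ j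
remQuot-injective {n} k {i} {j} eq =
  trans (sym (combine-remQuot {n} k i)) (trans (cong (uncurry combine) eq) (combine-remQuot {n} k j))

grid-hits-all-of-f-or-all-of-g : {A : Set} → DecidableEquality A → ∀ {ℓ}
  (f g : Fin ℓ → A) (c : Fin ℓ → Fin ℓ → A) → (∀ x y → c x y ≡ f x ⊎ c x y ≡ g y) →
  (∀ x → ∃ λ y → c x y ≡ f x) ⊎ (∀ y → ∃ λ x → c x y ≡ g y)
grid-hits-all-of-f-or-all-of-g _≟A_ {ℓ} f g c cxy∈fg with all? (λ x → any? (λ y → c x y ≟A f x))
... | yes every-f-hit = inj₁ every-f-hit
... | no ¬every-f-hit with ¬∀⟶∃¬ ℓ _ (λ x → any? (λ y → c x y ≟A f x)) ¬every-f-hit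
...   | x , f-x-missed = inj₂ λ y → x , row-x-is-g y (cxy∈fg x y)
  where
  row-x-is-g : ∀ y → c x y ≡ f x ⊎ c x y ≡ g y → c x y ≡ g y
  row-x-is-g y (inj₁ cxy≡fx) = contradiction (y , cxy≡fx) f-x-missed
  row-x-is-g y (inj₂ cxy≡gy) = cxy≡gy

module Construction (t ℓ : ℕ) where

  color : Fin t → Fin 2 → Fin ℓ → ℕ
  color j b k = toℕ (combine j (combine b k))

  color-injective : ∀ {j b k j′ b′ k′} → color j b k ≡ color j′ b′ k′ → j ≡ j′ × b ≡ b′ × k ≡ k′
  color-injective {j} {b} {k} {j′} {b′} {k′} eq
    with combine-injective j _ j′ _ (toℕ-injective eq)
  ... | refl , eq′ with combine-injective b k b′ k′ eq′
  ...   | refl , refl = refl , refl , refl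

  paletteA : Fin (2 ^ t) → Fin t × Fin ℓ → ℕ
  paletteA i (j , k) = color j (finToFun i j) k

  paletteA-injective : ∀ i {jk jk′} → paletteA i jk ≡ paletteA i jk′ → jk ≡ jk′
  paletteA-injective i {j , k} {j′ , k′} eq
    with color-injective {j} {finToFun i j} {k} {j′} {finToFun i j′} {k′} eq
  ... | refl , _ , refl = refl

  LA : Fin (2 ^ t) → List ℕ
  LA i = tabulate (paletteA i ∘ remQuot ℓ)

  LA-colorList : ∀ i → IsColorList (t * ℓ) (LA i)
  LA-colorList i = tabulate⁺ (remQuot-injective ℓ ∘ paletteA-injective i) , length-tabulate _

  listQ : Fin t → Fin ℓ → Fin ℓ → List ℕ
  listQ j x y = color j 0F x ∷ color j 1F y ∷ []

  listQ-colorList : ∀ j x y → IsColorList 2 (listQ j x y)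
  listQ-colorList j x y = ((λ eq → 0≢1 (proj₁ (proj₂ (color-injective eq)))) ∷ []) ∷ [] ∷ [] , refl
    where
    0≢1 : (Fin 2 ∋ 0F) ≢ 1F
    0≢1 ()

  LQ : Fin (t * (ℓ * ℓ)) → List ℕ
  LQ = uncurry (λ j → uncurry (listQ j) ∘ remQuot ℓ) ∘ remQuot (ℓ * ℓ)

  LQ-colorList : ∀ v → IsColorList 2 (LQ v)
  LQ-colorList v = listQ-colorList _ _ _

  vertexQ : Fin t → Fin ℓ → Fin ℓ → Fin (t * (ℓ * ℓ))
  vertexQ j x y = combine j (combine x y)

  LQ-vertexQ : ∀ j x y → LQ (vertexQ j x y) ≡ listQ j x y
  LQ-vertexQ j x y = trans
    (cong (uncurry (λ j → uncurry (listQ j) ∘ remQuot ℓ)) (remQuot-combine j (combine x y)))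
    (cong (uncurry (listQ j)) (remQuot-combine x y))

  module _ (cQ : Fin (t * (ℓ * ℓ)) → ℕ) (cQ∈LQ : ∀ v → cQ v ∈ LQ v) where

    Covered : Fin t → Fin 2 → Set
    Covered j b = ∀ k → ∃ λ v → cQ v ≡ color j b k

    grid-in-lists : ∀ j x y → cQ (vertexQ j x y) ≡ color j 0F x ⊎ cQ (vertexQ j x y) ≡ color j 1F y
    grid-in-lists j x y = ∈-pair⁻ (subst (cQ (vertexQ j x y) ∈_) (LQ-vertexQ j x y) (cQ∈LQ _))

    some-side-covered : ∀ j → ∃ (Covered j)
    some-side-covered j
      with grid-hits-all-of-f-or-all-of-g _≟_ (color j 0F) (color j 1F)
             (λ x y → cQ (vertexQ j x y)) (grid-in-lists j)
    ... | inj₁ covered = 0F , λ x → let (y , eq) = covered x in vertexQ j x y , eq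
    ... | inj₂ covered = 1F , λ y → let (x , eq) = covered y in vertexQ j x y , eq

    coveredSides : Fin t → Fin 2
    coveredSides = proj₁ ∘ some-side-covered

    paletteA-covered : ∀ jk → ∃ λ v → cQ v ≡ paletteA (funToFin coveredSides) jk
    paletteA-covered (j , k) rewrite finToFun-funToFin coveredSides j = proj₂ (some-side-covered j) k

    LA-covered : ∀ {c} → c ∈ LA (funToFin coveredSides) → ∃ λ v → cQ v ≡ c
    LA-covered c∈LA with ∈-tabulate⁻ c∈LA
    ... | m , refl = paletteA-covered (remQuot ℓ m)

  no-proper-coloring : ∀ cA cQ → ¬ ProperListColoringK (2 ^ t) (t * (ℓ * ℓ)) LA LQ cA cQ
  no-proper-coloring cA cQ (cA∈LA , cQ∈LQ , cA≢cQ) =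
    let i             = funToFin (coveredSides cQ cQ∈LQ)
        (v , cQv≡cAi) = LA-covered cQ cQ∈LQ (cA∈LA i)
    in cA≢cQ i v (sym cQv≡cAi)

-- The construction works for all t and ℓ.
lemma4p1 : (t ℓ : ℕ) → 2 ≤ t → 1 ≤ ℓ →
    Σ (Fin (2 ^ t) → List ℕ) λ LA →
    Σ (Fin (t * (ℓ * ℓ)) → List ℕ) λ LQ →
      ((i : Fin (2 ^ t)) → IsColorList (t * ℓ) (LA i)) ×
      ((j : Fin (t * (ℓ * ℓ))) → IsColorList 2 (LQ j)) ×
      ((cA : Fin (2 ^ t) → ℕ) → (cQ : Fin (t * (ℓ * ℓ)) → ℕ) →
        ¬ ProperListColoringK (2 ^ t) (t * (ℓ * ℓ)) LA LQ cA cQ)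
lemma4p1 t ℓ _ _ = LA , LQ , LA-colorList , LQ-colorList , no-proper-coloring
  where open Construction t ℓ
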